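{- There is a uniformly primitive recursive sequence $(V_n)_{n\in\omega}$ of dense open sets in $\omega^\omega$ (a primitive recursive instance of the Baire category theorem) such that no function in $\bigcap_n V_n$ is bounded by a primitive recursive function.
   Context: For $\sigma\in\omega^{<\omega}$, the basic open set $B_\sigma$ consists of all elements of $\omega^\omega$ extending $\sigma$. An open set is given by a listing of finite strings (basic open sets) whose union is the set; a sequence $(V_n)$ is uniformly primitive recursive if a single primitive recursive two-argument function lists, on row $n$, the basic open sets composing $V_n$. An open set $V$ is dense if every string has an extension lying in a basic open subset of $V$. A function $h$ is bounded by $g$ if $h(x)\le g(x)$ for all $x$. -}

module Defs where

open import Data.Nat using (ℕ; zero; suc; _≤_)
open import Data.Fin using (Fin)
open import Data.Vec using (Vec; []; _∷_; lookup)
open import Data.List using (List; []; _∷_)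
open import Data.Product using (Σ; _×_; _,_; proj₁; proj₂)
open import Data.Unit using (⊤)
open import Data.Empty using (⊥)
open import Relation.Binary.PropositionalEquality using (_≡_)

data PR : ℕ → Set where
  zeroF : ∀ {n} → PR n
  sucF  : PR 1
  proj  : ∀ {n} → Fin n → PR n
  comp  : ∀ {m n} → PR m → Vec (PR n) m → PR n
  rec   : ∀ {n} → PR n → PR (suc (suc n)) → PR (suc n)

mutual
  ⟦_⟧ : ∀ {n} → PR n → Vec ℕ n → ℕ
  ⟦ zeroF ⟧ xs = 0
  ⟦ sucF ⟧ (x ∷ []) = suc x
  ⟦ proj i ⟧ xs = lookup xs i
  ⟦ comp f gs ⟧ xs = ⟦ f ⟧ (⟦ gs ⟧* xs)
  ⟦ rec f g ⟧ (zero ∷ xs) = ⟦ f ⟧ xs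
  ⟦ rec f g ⟧ (suc y ∷ xs) = ⟦ g ⟧ (y ∷ ⟦ rec f g ⟧ (y ∷ xs) ∷ xs)

  ⟦_⟧* : ∀ {m n} → Vec (PR n) m → Vec ℕ n → Vec ℕ m
  ⟦ [] ⟧* xs = []
  ⟦ g ∷ gs ⟧* xs = ⟦ g ⟧ xs ∷ ⟦ gs ⟧* xs

-- Coding of finite strings (ω^{<ω}) by natural numbers.
-- unpair enumerates ℕ×ℕ along Cantor diagonals (a bijection ℕ ≅ ℕ×ℕ);
-- code 0 = [], code (1 + ⟨a,b⟩) = a ∷ (string coded by b).

unpair : ℕ → ℕ × ℕ
unpair zero = 0 , 0
unpair (suc n) with unpair n
... | zero , b = suc b , 0
... | suc a , b = a , suc b

-- fuel-bounded decoding; fuel n suffices for code n since b ≤ n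
decodeF : ℕ → ℕ → List ℕ
decodeF zero _ = []
decodeF (suc k) zero = []
decodeF (suc k) (suc n) = proj₁ (unpair n) ∷ decodeF k (proj₂ (unpair n))

decode : ℕ → List ℕ
decode n = decodeF n n

Baire : Set
Baire = ℕ → ℕ

_∈B_ : Baire → List ℕ → Set
x ∈B [] = ⊤
x ∈B (a ∷ σ) = (x 0 ≡ a) × ((λ k → x (suc k)) ∈B σ)

_⊑_ : List ℕ → List ℕ → Set
[] ⊑ τ = ⊤
(a ∷ σ) ⊑ [] = ⊥
(a ∷ σ) ⊑ (b ∷ τ) = (a ≡ b) × (σ ⊑ τ)

Listing : Set
Listing = ℕ → ℕ

_∈O_ : Baire → Listing → Set
x ∈O L = Σ ℕ λ i → x ∈B decode (L i)

Dense : Listing → Set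
Dense L = (τ : List ℕ) → Σ (List ℕ) λ ρ → (τ ⊑ ρ) × ((x : Baire) → x ∈B ρ → x ∈O L)

row : PR 2 → ℕ → Listing
row f n i = ⟦ f ⟧ (n ∷ i ∷ [])

BoundedBy : Baire → (ℕ → ℕ) → Set
BoundedBy h g = (k : ℕ) → h k ≤ g k

-- Row n lists the strings σ ++ [y] with ack n (length σ) ≤ y, where ack is the Ackermann
-- function.  That relation is not primitive recursive, but it becomes so once the index also
-- supplies a step bound for a stack machine computing ack; so the rows are uniformly primitive
-- recursive, and row n is dense because every τ extends to τ ++ [ack n (length τ)].  Every
-- primitive recursive g lies below ack c for some c, so a point x of all rows bounded by g
-- would satisfy ack n m ≤ x m ≤ g m < ack c m ≤ ack n m for a suitable row n ≥ c.

module Submission where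

open import Defs
open import Data.Nat using (ℕ; zero; suc; _+_; _∸_; _⊔_; _≤_; _<_; _<?_; z≤n; s≤s; pred)
open import Data.Nat.Properties
open import Data.Fin using (Fin; #_)
import Data.Fin as Fin
open import Data.Vec using (Vec; []; _∷_; lookup; sum)
open import Data.List using (List; []; _∷_; _++_; length; reverse)
open import Data.List.Properties using (unfold-reverse; ++-assoc; ++-identityʳ; length-reverse)
open import Data.Sum using (_⊎_; inj₁; inj₂)
open import Data.Unit using (tt)
open import Data.Product using (Σ; _×_; _,_; proj₁; proj₂)
open import Relation.Binary.Definitions using (tri<; tri≈; tri>)
open import Relation.Nullary.Decidable using (True)
open import Algebra.Properties.CommutativeSemigroup +-commutativeSemigroup using (x∙yz≈y∙xz)
open import Relation.Nullary using (¬_; contradiction)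
open import Relation.Binary.PropositionalEquality

record PRFun (n : ℕ) : Set where
  field
    fn              : Vec ℕ n → ℕ
    program         : PR n
    program-correct : ∀ xs → ⟦ program ⟧ xs ≡ fn xs

open PRFun

-- Expressions are evaluated through the functions attached to their building blocks, so
-- the equations demanded by exᴾ and recᴾ below mostly hold by refl.
data Ex (m : ℕ) : Set where
  var : Fin m → Ex m
  app : ∀ {k} → PRFun k → Vec (Ex m) k → Ex m

infix 10 ‵_

‵_ : ∀ i {m} {i<m : True (i <? m)} → Ex m
‵_ i {i<m = i<m} = var (#_ i {m<n = i<m})

mutual
  compile : ∀ {m} → Ex m → PR m
  compile (var i) = proj i
  compile (app f es) = comp (program f) (compile* es)

  compile* : ∀ {k m} → Vec (Ex m) k → Vec (PR m) k
  compile* [] = []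
  compile* (e ∷ es) = compile e ∷ compile* es

mutual
  eval : ∀ {m} → Ex m → Vec ℕ m → ℕ
  eval (var i) xs = lookup xs i
  eval (app f es) xs = fn f (eval* es xs)

  eval* : ∀ {k m} → Vec (Ex m) k → Vec ℕ m → Vec ℕ k
  eval* [] xs = []
  eval* (e ∷ es) xs = eval e xs ∷ eval* es xs

mutual
  compile-correct : ∀ {m} (e : Ex m) xs → ⟦ compile e ⟧ xs ≡ eval e xs
  compile-correct (var i) xs = refl
  compile-correct (app f es) xs =
    trans (cong ⟦ program f ⟧ (compile*-correct es xs)) (program-correct f _)

  compile*-correct : ∀ {k m} (es : Vec (Ex m) k) xs → ⟦ compile* es ⟧* xs ≡ eval* es xs
  compile*-correct [] xs = refl
  compile*-correct (e ∷ es) xs = cong₂ _∷_ (compile-correct e xs) (compile*-correct es xs)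

exᴾ : ∀ {n} (F : Vec ℕ n → ℕ) (e : Ex n) → (∀ xs → eval e xs ≡ F xs) → PRFun n
exᴾ F e e≗F = record
  { fn = F ; program = compile e
  ; program-correct = λ xs → trans (compile-correct e xs) (e≗F xs) }

recᴾ : ∀ {n} (h : Vec ℕ (suc n) → ℕ) (f : Ex n) (g : Ex (suc (suc n))) →
       (∀ xs → h (0 ∷ xs) ≡ eval f xs) →
       (∀ y xs → h (suc y ∷ xs) ≡ eval g (y ∷ h (y ∷ xs) ∷ xs)) →
       PRFun (suc n)
recᴾ h f g base step = record
  { fn = h ; program = rec (compile f) (compile g) ; program-correct = correct }
  where
  correct : ∀ xs → ⟦ rec (compile f) (compile g) ⟧ xs ≡ h xs
  correct (zero ∷ xs) = trans (compile-correct f xs) (sym (base xs))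
  correct (suc y ∷ xs) = begin
      ⟦ compile g ⟧ (y ∷ ⟦ rec (compile f) (compile g) ⟧ (y ∷ xs) ∷ xs)
    ≡⟨ compile-correct g _ ⟩
      eval g (y ∷ ⟦ rec (compile f) (compile g) ⟧ (y ∷ xs) ∷ xs)
    ≡⟨ cong (λ v → eval g (y ∷ v ∷ xs)) (correct (y ∷ xs)) ⟩
      eval g (y ∷ h (y ∷ xs) ∷ xs)
    ≡⟨ sym (step y xs) ⟩
      h (suc y ∷ xs) ∎
    where open ≡-Reasoning

zeroᴾ : ∀ {n} → PRFun n
zeroᴾ = record { fn = λ _ → 0 ; program = zeroF ; program-correct = λ _ → refl }

sucᴾ : PRFun 1
sucᴾ = record
  { fn = λ { (x ∷ []) → suc x } ; program = sucF ; program-correct = λ { (x ∷ []) → refl } }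

0ₑ : ∀ {m} → Ex m
0ₑ = app zeroᴾ []

sucₑ : ∀ {m} → Ex m → Ex m
sucₑ e = app sucᴾ (e ∷ [])

app₁ : ∀ {m} → PRFun 1 → Ex m → Ex m
app₁ f a = app f (a ∷ [])

app₂ : ∀ {m} → PRFun 2 → Ex m → Ex m → Ex m
app₂ f a b = app f (a ∷ b ∷ [])

app₃ : ∀ {m} → PRFun 3 → Ex m → Ex m → Ex m → Ex m
app₃ f a b c = app f (a ∷ b ∷ c ∷ [])

addᴾ : PRFun 2
addᴾ = recᴾ (λ { (a ∷ b ∷ []) → a + b }) (‵ 0) (sucₑ (‵ 1))
  (λ { (b ∷ []) → refl }) (λ { a (b ∷ []) → refl })

infixl 6 _+ₑ_ _∸ₑ_

_+ₑ_ : ∀ {m} → Ex m → Ex m → Ex m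
_+ₑ_ = app₂ addᴾ

predᴾ : PRFun 1
predᴾ = recᴾ (λ { (a ∷ []) → pred a }) 0ₑ (‵ 0)
  (λ { [] → refl }) (λ { a [] → refl })

monusᴾ : PRFun 2
monusᴾ = recᴾ (λ { (k ∷ b ∷ []) → b ∸ k }) (‵ 0) (app₁ predᴾ (‵ 1))
  (λ { (b ∷ []) → refl }) (λ { k (b ∷ []) → sym (pred[m∸n]≡m∸[1+n] b k) })

_∸ₑ_ : ∀ {m} → Ex m → Ex m → Ex m
a ∸ₑ b = app₂ monusᴾ b a

ifZero : ℕ → ℕ → ℕ → ℕ
ifZero zero    a b = a
ifZero (suc _) a b = b

ifZeroᴾ : PRFun 3
ifZeroᴾ = recᴾ (λ { (z ∷ a ∷ b ∷ []) → ifZero z a b }) (‵ 0) (‵ 3)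
  (λ { (a ∷ b ∷ []) → refl }) (λ { z (a ∷ b ∷ []) → refl })

ifZeroₑ : ∀ {m} → Ex m → Ex m → Ex m → Ex m
ifZeroₑ = app₃ ifZeroᴾ

-- Cantor pairing and codes of strings

tri : ℕ → ℕ
tri zero    = 0
tri (suc s) = tri s + suc s

triᴾ : PRFun 1
triᴾ = recᴾ (λ { (s ∷ []) → tri s }) 0ₑ (‵ 1 +ₑ sucₑ (‵ 0))
  (λ { [] → refl }) (λ { s [] → refl })

triₑ : ∀ {m} → Ex m → Ex m
triₑ = app₁ triᴾ

pair : ℕ → ℕ → ℕ
pair a b = tri (a + b) + b

pairᴾ : PRFun 2
pairᴾ = exᴾ (λ { (a ∷ b ∷ []) → pair a b }) (triₑ (‵ 0 +ₑ ‵ 1) +ₑ ‵ 1)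
  (λ { (a ∷ b ∷ []) → refl })

pairₑ : ∀ {m} → Ex m → Ex m → Ex m
pairₑ = app₂ pairᴾ

root : ℕ → ℕ
root zero    = 0
root (suc i) = ifZero (tri (suc (root i)) ∸ suc i) (suc (root i)) (root i)

rootᴾ : PRFun 1
rootᴾ = recᴾ (λ { (i ∷ []) → root i }) 0ₑ
  (ifZeroₑ (triₑ (sucₑ (‵ 1)) ∸ₑ sucₑ (‵ 0)) (sucₑ (‵ 1)) (‵ 1))
  (λ { [] → refl }) (λ { i [] → refl })

snd : ℕ → ℕ
snd i = i ∸ tri (root i)

fst : ℕ → ℕ
fst i = root i ∸ snd i

sndᴾ : PRFun 1
sndᴾ = exᴾ (λ { (i ∷ []) → snd i }) (‵ 0 ∸ₑ triₑ (app₁ rootᴾ (‵ 0)))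
  (λ { (i ∷ []) → refl })

fstᴾ : PRFun 1
fstᴾ = exᴾ (λ { (i ∷ []) → fst i }) (app₁ rootᴾ (‵ 0) ∸ₑ app₁ sndᴾ (‵ 0))
  (λ { (i ∷ []) → refl })

fstₑ sndₑ : ∀ {m} → Ex m → Ex m
fstₑ = app₁ fstᴾ
sndₑ = app₁ sndᴾ

tri-mono : ∀ {a b} → a ≤ b → tri a ≤ tri b
tri-mono {zero}  {b}     _       = z≤n
tri-mono {suc a} {suc b} (s≤s p) = +-mono-≤ (tri-mono p) (s≤s p)

root-spec : ∀ i → tri (root i) ≤ i × i < tri (suc (root i))
root-spec zero = z≤n , s≤s z≤n
root-spec (suc i) with root-spec i
... | lo , hi with tri (suc (root i)) ∸ suc i in eq
... | zero  = m∸n≡0⇒m≤n eq , ≤-trans (s≤s hi) (m<m+n (tri (suc (root i))) (s≤s z≤n))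
... | suc _ = m≤n⇒m≤1+n lo , ≰⇒> (λ le → 0≢1+n (trans (sym (m≤n⇒m∸n≡0 le)) eq))

root-unique : ∀ {i r} → tri r ≤ i → i < tri (suc r) → root i ≡ r
root-unique {i} {r} lo hi with <-cmp (root i) r | root-spec i
... | tri≈ _ e _ | _ = e
... | tri< lt _ _ | _ , hi′ = contradiction (≤-trans (tri-mono lt) lo) (<⇒≱ hi′)
... | tri> _ _ gt | lo′ , _ = contradiction (≤-trans (tri-mono gt) lo′) (<⇒≱ hi)

root-pair : ∀ a b → root (pair a b) ≡ a + b
root-pair a b = root-unique (m≤m+n _ _) (+-monoʳ-< (tri (a + b)) (s≤s (m≤n+m b a)))

snd-pair : ∀ a b → snd (pair a b) ≡ b
snd-pair a b rewrite root-pair a b = m+n∸m≡n (tri (a + b)) b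

fst-pair : ∀ a b → fst (pair a b) ≡ a
fst-pair a b rewrite snd-pair a b | root-pair a b = m+n∸n≡m a b

unpair-next : ℕ × ℕ → ℕ × ℕ
unpair-next (zero  , b) = suc b , 0
unpair-next (suc a , b) = a , suc b

unpair-suc : ∀ n → unpair (suc n) ≡ unpair-next (unpair n)
unpair-suc n with unpair n
... | zero  , b = refl
... | suc a , b = refl

unpair-tri+ : ∀ s b → b ≤ s → unpair (tri s + b) ≡ (s ∸ b , b)
unpair-tri+ zero    zero    _ = refl
unpair-tri+ (suc s) zero    _ = begin
    unpair (tri s + suc s + 0)
  ≡⟨ cong unpair (trans (+-identityʳ _) (+-suc (tri s) s)) ⟩
    unpair (suc (tri s + s))
  ≡⟨ unpair-suc (tri s + s) ⟩
    unpair-next (unpair (tri s + s))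
  ≡⟨ cong unpair-next (unpair-tri+ s s ≤-refl) ⟩
    unpair-next (s ∸ s , s)
  ≡⟨ cong (λ a → unpair-next (a , s)) (n∸n≡0 s) ⟩
    (suc s , 0) ∎
  where open ≡-Reasoning
unpair-tri+ (suc s) (suc b) (s≤s b≤s) = begin
    unpair (tri (suc s) + suc b)
  ≡⟨ cong unpair (+-suc (tri (suc s)) b) ⟩
    unpair (suc (tri (suc s) + b))
  ≡⟨ unpair-suc (tri (suc s) + b) ⟩
    unpair-next (unpair (tri (suc s) + b))
  ≡⟨ cong unpair-next (unpair-tri+ (suc s) b (m≤n⇒m≤1+n b≤s)) ⟩
    unpair-next (suc s ∸ b , b)
  ≡⟨ cong (λ a → unpair-next (a , b)) (+-∸-assoc 1 b≤s) ⟩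
    (s ∸ b , suc b) ∎
  where open ≡-Reasoning

unpair-pair : ∀ a b → unpair (pair a b) ≡ (a , b)
unpair-pair a b = trans (unpair-tri+ (a + b) b (m≤n+m b a)) (cong (_, b) (m+n∸n≡m a b))

unpair-sum≤ : ∀ n → proj₁ (unpair n) + proj₂ (unpair n) ≤ n
unpair-sum≤ zero = z≤n
unpair-sum≤ (suc n) rewrite unpair-suc n with unpair n | unpair-sum≤ n
... | zero  , b | le = s≤s (≤-trans (≤-reflexive (+-identityʳ b)) le)
... | suc a , b | le = m≤n⇒m≤1+n (≤-trans (≤-reflexive (+-suc a b)) le)

decodeF-fuel : ∀ k k′ n → n ≤ k → n ≤ k′ → decodeF k n ≡ decodeF k′ n
decodeF-fuel zero    zero     zero    _       _        = refl
decodeF-fuel zero    (suc k′) zero    _       _        = refl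
decodeF-fuel (suc k) zero     zero    _       _        = refl
decodeF-fuel (suc k) (suc k′) zero    _       _        = refl
decodeF-fuel (suc k) (suc k′) (suc n) (s≤s le) (s≤s le′) =
  cong (proj₁ (unpair n) ∷_) (decodeF-fuel k k′ _ (≤-trans snd≤n le) (≤-trans snd≤n le′))
  where
  snd≤n : proj₂ (unpair n) ≤ n
  snd≤n = ≤-trans (m≤n+m _ _) (unpair-sum≤ n)

cons : ℕ → ℕ → ℕ
cons a n = suc (pair a n)

decode-cons : ∀ a n → decode (cons a n) ≡ a ∷ decode n
decode-cons a n = begin
    proj₁ (unpair (pair a n)) ∷ decodeF (pair a n) (proj₂ (unpair (pair a n)))
  ≡⟨ cong (λ p → proj₁ p ∷ decodeF (pair a n) (proj₂ p)) (unpair-pair a n) ⟩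
    a ∷ decodeF (pair a n) n
  ≡⟨ cong (a ∷_) (decodeF-fuel (pair a n) n n (m≤n+m n _) ≤-refl) ⟩
    a ∷ decode n ∎
  where open ≡-Reasoning

encode : List ℕ → ℕ
encode []      = 0
encode (a ∷ σ) = cons a (encode σ)

decode-encode : ∀ σ → decode (encode σ) ≡ σ
decode-encode []      = refl
decode-encode (a ∷ σ) = trans (decode-cons a (encode σ)) (cong (a ∷_) (decode-encode σ))

hd tl : ℕ → ℕ
hd c = fst (pred c)
tl c = snd (pred c)

hd-cons : ∀ a n → hd (cons a n) ≡ a
hd-cons = fst-pair

tl-cons : ∀ a n → tl (cons a n) ≡ n
tl-cons = snd-pair

iter : ∀ {A : Set} → (A → A) → ℕ → A → A
iter f zero    x = x
iter f (suc t) x = f (iter f t x)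

module _ {A : Set} (f : A → A) where

  iter-+ : ∀ s t x → iter f (s + t) x ≡ iter f s (iter f t x)
  iter-+ zero    t x = refl
  iter-+ (suc s) t x = cong f (iter-+ s t x)

  iter-suc : ∀ t x → iter f (suc t) x ≡ iter f t (f x)
  iter-suc t x = trans (cong (λ s → iter f s x) (+-comm 1 t)) (iter-+ t 1 x)

  iter-fixed : ∀ {a} → f a ≡ a → ∀ t → iter f t a ≡ a
  iter-fixed fa≡a zero    = refl
  iter-fixed fa≡a (suc t) = trans (cong f (iter-fixed fa≡a t)) fa≡a

  iter-fixed-unique : ∀ {x a b} s t → f a ≡ a → f b ≡ b →
                      iter f s x ≡ a → iter f t x ≡ b → a ≡ b
  iter-fixed-unique {x} {a} {b} s t fa≡a fb≡b reach-a reach-b = begin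
    a                     ≡⟨ sym (iter-fixed fa≡a t) ⟩
    iter f t a            ≡⟨ cong (iter f t) (sym reach-a) ⟩
    iter f t (iter f s x) ≡⟨ sym (iter-+ t s x) ⟩
    iter f (t + s) x      ≡⟨ cong (λ r → iter f r x) (+-comm t s) ⟩
    iter f (s + t) x      ≡⟨ iter-+ s t x ⟩
    iter f s (iter f t x) ≡⟨ cong (iter f s) reach-b ⟩
    iter f s b            ≡⟨ iter-fixed fb≡b s ⟩
    b                     ∎
    where open ≡-Reasoning

iter-natural : ∀ {A B : Set} {f : A → A} {g : B → B} (h : A → B) →
               (∀ x → g (h x) ≡ h (f x)) → ∀ t x → iter g t (h x) ≡ h (iter f t x)
iter-natural h comm zero    x = refl
iter-natural {g = g} h comm (suc t) x = trans (cong g (iter-natural h comm t x)) (comm _)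

iterᴾ : PRFun 1 → PRFun 2
iterᴾ f = recᴾ (λ { (t ∷ x ∷ []) → iter (λ y → fn f (y ∷ [])) t x }) (‵ 0) (app₁ f (‵ 1))
  (λ { (x ∷ []) → refl }) (λ { t (x ∷ []) → refl })

iter-tl-encode : ∀ σ κ → iter tl (length σ) (encode (σ ++ κ)) ≡ encode κ
iter-tl-encode []      κ = refl
iter-tl-encode (a ∷ σ) κ = begin
    iter tl (suc (length σ)) (encode (a ∷ σ ++ κ)) ≡⟨ iter-suc tl (length σ) _ ⟩
    iter tl (length σ) (tl (encode (a ∷ σ ++ κ)))  ≡⟨ cong (iter tl (length σ)) (tl-cons a _) ⟩
    iter tl (length σ) (encode (σ ++ κ))           ≡⟨ iter-tl-encode σ κ ⟩
    encode κ                                       ∎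
  where open ≡-Reasoning

takeRev : ℕ → ℕ → List ℕ
takeRev zero    c = []
takeRev (suc j) c = hd (iter tl j c) ∷ takeRev j c

length-takeRev : ∀ j c → length (takeRev j c) ≡ j
length-takeRev zero    c = refl
length-takeRev (suc j) c = cong suc (length-takeRev j c)

takeRev-reverse : ∀ ρ κ → takeRev (length ρ) (encode (reverse ρ ++ κ)) ≡ ρ
takeRev-reverse []      κ = refl
takeRev-reverse (a ∷ ρ) κ = begin
    takeRev (suc (length ρ)) (encode (reverse (a ∷ ρ) ++ κ))
  ≡⟨ cong (λ σ → takeRev (suc (length ρ)) (encode σ)) reverse-cons-++ ⟩
    takeRev (suc (length ρ)) (encode (reverse ρ ++ a ∷ κ))
  ≡⟨ cong₂ _∷_ head (takeRev-reverse ρ (a ∷ κ)) ⟩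
    a ∷ ρ ∎
  where
  open ≡-Reasoning
  reverse-cons-++ : reverse (a ∷ ρ) ++ κ ≡ reverse ρ ++ a ∷ κ
  reverse-cons-++ = trans (cong (_++ κ) (unfold-reverse a ρ)) (++-assoc (reverse ρ) (a ∷ []) κ)
  head : hd (iter tl (length ρ) (encode (reverse ρ ++ a ∷ κ))) ≡ a
  head = trans (cong (λ n → hd (iter tl n (encode (reverse ρ ++ a ∷ κ)))) (sym (length-reverse ρ)))
               (trans (cong hd (iter-tl-encode (reverse ρ) (a ∷ κ))) (hd-cons a (encode κ)))

-- Primitive recursion on j keeps c fixed, so the string is built from its last entry
-- backwards and c has to code the prefix in reverse.
prepend : ℕ → ℕ → ℕ → ℕ
prepend zero    c s = s
prepend (suc j) c s = cons (hd (iter tl j c)) (prepend j c s)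

prepend-encode : ∀ j c σ → prepend j c (encode σ) ≡ encode (takeRev j c ++ σ)
prepend-encode zero    c σ = refl
prepend-encode (suc j) c σ = cong (cons (hd (iter tl j c))) (prepend-encode j c σ)

consᴾ : PRFun 2
consᴾ = exᴾ (λ { (a ∷ n ∷ []) → cons a n }) (sucₑ (pairₑ (‵ 0) (‵ 1)))
  (λ { (a ∷ n ∷ []) → refl })

hdᴾ tlᴾ : PRFun 1
hdᴾ = exᴾ (λ { (c ∷ []) → hd c }) (fstₑ (app₁ predᴾ (‵ 0))) (λ { (c ∷ []) → refl })
tlᴾ = exᴾ (λ { (c ∷ []) → tl c }) (sndₑ (app₁ predᴾ (‵ 0))) (λ { (c ∷ []) → refl })

consₑ : ∀ {m} → Ex m → Ex m → Ex m
consₑ = app₂ consᴾ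

hdₑ tlₑ : ∀ {m} → Ex m → Ex m
hdₑ = app₁ hdᴾ
tlₑ = app₁ tlᴾ

prependᴾ : PRFun 3
prependᴾ = recᴾ (λ { (j ∷ c ∷ s ∷ []) → prepend j c s }) (‵ 1)
  (consₑ (hdₑ (app₂ (iterᴾ tlᴾ) (‵ 0) (‵ 2))) (‵ 1))
  (λ { (c ∷ s ∷ []) → refl }) (λ { j (c ∷ s ∷ []) → refl })

-- The Ackermann function and a stack machine computing it

ack : ℕ → ℕ → ℕ
ack zero    m       = suc m
ack (suc n) zero    = ack n 1
ack (suc n) (suc m) = ack n (ack (suc n) m)

-- A state (n ∷ s , m) of the stack machine is to be read as "compute ack n m, then
-- continue with the stack s"; an empty stack means the machine has halted.
State : Set
State = List ℕ × ℕ

step : State → State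
step ([]          , m)     = [] , m
step (zero  ∷ s   , m)     = s , suc m
step (suc n ∷ s   , zero)  = n ∷ s , 1
step (suc n ∷ s   , suc m) = suc n ∷ n ∷ s , m

step-computes-ack : ∀ n m s → Σ ℕ λ T → iter step T (n ∷ s , m) ≡ (s , ack n m)
step-computes-ack zero m s = 1 , refl
step-computes-ack (suc n) zero s with step-computes-ack n 1 s
... | T , run = T + 1 , trans (iter-+ step T 1 _) run
step-computes-ack (suc n) (suc m) s with step-computes-ack (suc n) m (n ∷ s)
... | T₁ , run₁ with step-computes-ack n (ack (suc n) m) s
... | T₂ , run₂ = T₂ + (T₁ + 1) , (begin
    iter step (T₂ + (T₁ + 1)) (suc n ∷ s , suc m)        ≡⟨ iter-+ step T₂ (T₁ + 1) _ ⟩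
    iter step T₂ (iter step (T₁ + 1) (suc n ∷ s , suc m)) ≡⟨ cong (iter step T₂) (iter-+ step T₁ 1 _) ⟩
    iter step T₂ (iter step T₁ (suc n ∷ n ∷ s , m))       ≡⟨ cong (iter step T₂) run₁ ⟩
    iter step T₂ (n ∷ s , ack (suc n) m)                  ≡⟨ run₂ ⟩
    (s , ack (suc n) (suc m))                             ∎)
  where open ≡-Reasoning

halting-output-is-ack : ∀ n m t r → iter step t (n ∷ [] , m) ≡ ([] , r) → r ≡ ack n m
halting-output-is-ack n m t r run with step-computes-ack n m []
... | T , run′ = cong proj₂ (iter-fixed-unique step t T refl refl run run′)

encodeState : State → ℕ
encodeState (s , m) = pair (encode s) m

stepCode : ℕ → ℕ
stepCode st = ifZero (fst st) st
  (ifZero (hd (fst st)) (pair (tl (fst st)) (suc (snd st)))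
    (ifZero (snd st) (pair (cons (pred (hd (fst st))) (tl (fst st))) 1)
      (pair (cons (hd (fst st)) (cons (pred (hd (fst st))) (tl (fst st)))) (pred (snd st)))))

stepᴾ : PRFun 1
stepᴾ = exᴾ (λ { (st ∷ []) → stepCode st })
  (ifZeroₑ S (‵ 0)
    (ifZeroₑ A (pairₑ S′ (sucₑ M))
      (ifZeroₑ M (pairₑ (consₑ (app₁ predᴾ A) S′) (sucₑ 0ₑ))
        (pairₑ (consₑ A (consₑ (app₁ predᴾ A) S′)) (app₁ predᴾ M)))))
  (λ { (st ∷ []) → refl })
  where
  S M A S′ : Ex 1
  S  = fstₑ (‵ 0)
  M  = sndₑ (‵ 0)
  A  = hdₑ S
  S′ = tlₑ S

stepCode-correct : ∀ st → stepCode (encodeState st) ≡ encodeState (step st)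
stepCode-correct ([] , m) rewrite fst-pair 0 m = refl
stepCode-correct (a ∷ s , m)
  rewrite fst-pair (cons a (encode s)) m | snd-pair (cons a (encode s)) m
        | hd-cons a (encode s) | tl-cons a (encode s) with a | m
... | zero  | m     = refl
... | suc n | zero  = refl
... | suc n | suc m = refl

-- Zero exactly when the machine started on (n , m) has halted within T steps with
-- output at most y; the step bound T makes this test primitive recursive.
ackTest : ℕ → ℕ → ℕ → ℕ → ℕ
ackTest n m y T = fst st + (snd st ∸ y)
  where st = iter stepCode T (pair (encode (n ∷ [])) m)

ackTest-state : ∀ n m y T → let (s , r) = iter step T (n ∷ [] , m) in
                ackTest n m y T ≡ encode s + (r ∸ y)
ackTest-state n m y T = cong₂ (λ a b → a + (b ∸ y))
  (trans (cong fst run) (fst-pair (encode s) r)) (trans (cong snd run) (snd-pair (encode s) r))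
  where
  s = proj₁ (iter step T (n ∷ [] , m))
  r = proj₂ (iter step T (n ∷ [] , m))
  run : iter stepCode T (encodeState (n ∷ [] , m)) ≡ encodeState (iter step T (n ∷ [] , m))
  run = iter-natural encodeState stepCode-correct T (n ∷ [] , m)

ackTest-complete : ∀ n m y → ack n m ≤ y → Σ ℕ λ T → ackTest n m y T ≡ 0
ackTest-complete n m y ack≤y with step-computes-ack n m []
... | T , run = T , trans (ackTest-state n m y T)
  (subst (λ (s , r) → encode s + (r ∸ y) ≡ 0) (sym run) (m≤n⇒m∸n≡0 ack≤y))

ackTest-sound : ∀ n m y T → ackTest n m y T ≡ 0 → ack n m ≤ y
ackTest-sound n m y T test≡0 with iter step T (n ∷ [] , m) in run | ackTest-state n m y T
... | [] , r | test≡r∸y =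
  subst (_≤ y) (halting-output-is-ack n m T r run) (m∸n≡0⇒m≤n (trans (sym test≡r∸y) test≡0))
... | a ∷ s , r | test≡suc = contradiction (trans (sym test≡suc) test≡0) λ ()

-- The dense open sets

-- Row n lists, for the index i = ⟨c, m, y, T⟩, the reverse of the first m entries of the
-- string coded by c followed by y, provided T certifies ack n m ≤ y; all other indices
-- list the harmless string (n + 1).
entryAt : ℕ → ℕ → ℕ → ℕ → ℕ → ℕ
entryAt n c m y T = ifZero (ackTest n m y T) (prepend m c (encode (y ∷ []))) (encode (suc n ∷ []))

entry : ℕ → ℕ → ℕ
entry n i = entryAt n (fst i) (fst (snd i)) (fst (snd (snd i))) (snd (snd (snd i)))

index : ℕ → ℕ → ℕ → ℕ → ℕ
index c m y T = pair c (pair m (pair y T))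

entry-index : ∀ n c m y T → entry n (index c m y T) ≡ entryAt n c m y T
entry-index n c m y T
  rewrite fst-pair c (pair m (pair y T)) | snd-pair c (pair m (pair y T))
        | fst-pair m (pair y T) | snd-pair m (pair y T) | fst-pair y T | snd-pair y T = refl

entryᴾ : PRFun 2
entryᴾ = exᴾ (λ { (n ∷ i ∷ []) → entry n i })
  (ifZeroₑ (fstₑ St +ₑ (sndₑ St ∸ₑ Y))
    (app₃ prependᴾ M C (consₑ Y 0ₑ))
    (consₑ (sucₑ (‵ 0)) 0ₑ))
  (λ { (n ∷ i ∷ []) → refl })
  where
  C M Y T St : Ex 2
  C  = fstₑ (‵ 1)
  M  = fstₑ (sndₑ (‵ 1))
  Y  = fstₑ (sndₑ (sndₑ (‵ 1)))
  T  = sndₑ (sndₑ (sndₑ (‵ 1)))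
  St = app₂ (iterᴾ stepᴾ) T (pairₑ (consₑ (‵ 0) 0ₑ) M)

listingPR : PR 2
listingPR = program entryᴾ

row-listing : ∀ n i → row listingPR n i ≡ entry n i
row-listing n i = program-correct entryᴾ (n ∷ i ∷ [])

⊑-++ : ∀ τ ρ → τ ⊑ (τ ++ ρ)
⊑-++ []      ρ = tt
⊑-++ (a ∷ τ) ρ = refl , ⊑-++ τ ρ

∈B-++-last : ∀ (x : Baire) σ y → x ∈B (σ ++ y ∷ []) → x (length σ) ≡ y
∈B-++-last x []      y (x0≡y , _) = x0≡y
∈B-++-last x (a ∷ σ) y (_ , rest) = ∈B-++-last (λ k → x (suc k)) σ y rest

listing-dense : ∀ n → Dense (row listingPR n)
listing-dense n τ = τ ++ y ∷ [] , ⊑-++ τ (y ∷ []) , λ x x∈ → index c m y T , subst (x ∈B_) (sym decode-row) x∈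
  where
  m = length τ
  y = ack n m
  c = encode (reverse τ)
  T = proj₁ (ackTest-complete n m y ≤-refl)
  decode-row : decode (row listingPR n (index c m y T)) ≡ τ ++ y ∷ []
  decode-row = begin
      decode (row listingPR n (index c m y T))
    ≡⟨ cong decode (trans (row-listing n (index c m y T)) (entry-index n c m y T)) ⟩
      decode (ifZero (ackTest n m y T) (prepend m c (encode (y ∷ []))) (encode (suc n ∷ [])))
    ≡⟨ cong (λ t → decode (ifZero t (prepend m c (encode (y ∷ []))) (encode (suc n ∷ []))))
            (proj₂ (ackTest-complete n m y ≤-refl)) ⟩
      decode (prepend m c (encode (y ∷ [])))
    ≡⟨ cong decode (prepend-encode m c (y ∷ [])) ⟩
      decode (encode (takeRev m c ++ y ∷ []))
    ≡⟨ decode-encode _ ⟩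
      takeRev m c ++ y ∷ []
    ≡⟨ cong (λ c′ → takeRev m (encode c′) ++ y ∷ []) (sym (++-identityʳ (reverse τ))) ⟩
      takeRev m (encode (reverse τ ++ [])) ++ y ∷ []
    ≡⟨ cong (_++ y ∷ []) (takeRev-reverse τ []) ⟩
      τ ++ y ∷ [] ∎
    where open ≡-Reasoning

listing-points : ∀ (x : Baire) n → x ∈O row listingPR n → (Σ ℕ λ m → ack n m ≤ x m) ⊎ x 0 ≡ suc n
listing-points x n (i , x∈) = entryAt-points (fst i) (fst (snd i)) (fst (snd (snd i))) (snd (snd (snd i)))
  (subst (λ e → x ∈B decode e) (row-listing n i) x∈)
  where
  entryAt-points : ∀ c m y T → x ∈B decode (entryAt n c m y T) → (Σ ℕ λ m → ack n m ≤ x m) ⊎ x 0 ≡ suc n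
  entryAt-points c m y T x∈ with ackTest n m y T in test≡
  ... | zero  = inj₁ (m , subst (ack n m ≤_) (sym xm≡y) (ackTest-sound n m y T test≡))
    where
    xm≡y : x m ≡ y
    xm≡y = trans (cong x (sym (length-takeRev m c)))
      (∈B-++-last x (takeRev m c) y
        (subst (x ∈B_) (trans (cong decode (prepend-encode m c (y ∷ []))) (decode-encode _)) x∈))
  ... | suc _ = inj₂ (proj₁ (subst (x ∈B_) (decode-encode (suc n ∷ [])) x∈))

-- Ackermann majorises every primitive recursive function

<-ack : ∀ n m → m < ack n m
<-ack zero    m       = ≤-refl
<-ack (suc n) zero    = <-trans (s≤s z≤n) (<-ack n 1)
<-ack (suc n) (suc m) = ≤-<-trans (<-ack (suc n) m) (<-ack n _)

ack-<-suc : ∀ n m → ack n m < ack n (suc m)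
ack-<-suc zero    m = ≤-refl
ack-<-suc (suc n) m = <-ack n _

ack-monoʳ-≤ : ∀ n {m m′} → m ≤ m′ → ack n m ≤ ack n m′
ack-monoʳ-≤ n {m} {m′} m≤m′ with m≤n⇒∃[o]m+o≡n m≤m′
... | d , refl = go d
  where
  go : ∀ d → ack n m ≤ ack n (m + d)
  go zero    rewrite +-identityʳ m = ≤-refl
  go (suc d) rewrite +-suc m d     = ≤-trans (go d) (<⇒≤ (ack-<-suc n _))

ack-monoʳ-< : ∀ n {m m′} → m < m′ → ack n m < ack n m′
ack-monoʳ-< n {m} m<m′ = <-≤-trans (ack-<-suc n m) (ack-monoʳ-≤ n m<m′)

ack-suc≤ : ∀ n m → ack n (suc m) ≤ ack (suc n) m
ack-suc≤ n zero    = ≤-refl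
ack-suc≤ n (suc m) = ack-monoʳ-≤ n (≤-trans (<-ack n (suc m)) (ack-suc≤ n m))

ack-<-sucˡ : ∀ n m → ack n m < ack (suc n) m
ack-<-sucˡ n m = <-≤-trans (ack-<-suc n m) (ack-suc≤ n m)

ack-monoˡ-≤ : ∀ {n n′} m → n ≤ n′ → ack n m ≤ ack n′ m
ack-monoˡ-≤ {n} m n≤n′ with m≤n⇒∃[o]m+o≡n n≤n′
... | d , refl = go d
  where
  go : ∀ d → ack n m ≤ ack (n + d) m
  go zero    rewrite +-identityʳ n = ≤-refl
  go (suc d) rewrite +-suc n d     = ≤-trans (go d) (<⇒≤ (ack-<-sucˡ _ m))

ack-nested : ∀ c k m → k ≤ c → ack c (ack k m) < ack (2 + c) m
ack-nested c k m k≤c = <-≤-trans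
  (ack-monoʳ-< c (≤-<-trans (ack-monoˡ-≤ m k≤c) (ack-<-sucˡ c m)))
  (ack-suc≤ (suc c) m)

ack-double : ∀ c m → ack c m + ack c m < ack (4 + c) m
ack-double c m = <-≤-trans (double<ack₂ (ack c m))
  (<⇒≤ (≤-<-trans (ack-monoˡ-≤ (ack c m) (m≤m+n 2 c)) (ack-nested (2 + c) c m (m≤n+m c 2))))
  where
  ack₁ : ∀ k → ack 1 k ≡ 2 + k
  ack₁ zero    = refl
  ack₁ (suc k) = cong suc (ack₁ k)
  double<ack₂ : ∀ u → u + u < ack 2 u
  double<ack₂ zero    = s≤s z≤n
  double<ack₂ (suc u) rewrite ack₁ (ack 2 u) | +-suc u u = s≤s (s≤s (double<ack₂ u))

AckBounded : ∀ {n} → PR n → ℕ → Set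
AckBounded p c = ∀ xs → ⟦ p ⟧ xs < ack c (sum xs)

lookup≤sum : ∀ {n} (xs : Vec ℕ n) i → lookup xs i ≤ sum xs
lookup≤sum (x ∷ xs) Fin.zero    = m≤m+n x _
lookup≤sum (x ∷ xs) (Fin.suc i) = ≤-trans (lookup≤sum xs i) (m≤n+m _ x)

comp-ackBounded : ∀ {m n} {f : PR m} {gs : Vec (PR n) m} {cf cg} → AckBounded f cf →
                  (∀ xs → sum (⟦ gs ⟧* xs) < ack cg (sum xs)) → AckBounded (comp f gs) (2 + (cf ⊔ cg))
comp-ackBounded {f = f} {gs} {cf} {cg} hf hgs xs = begin-strict
    ⟦ f ⟧ (⟦ gs ⟧* xs)            <⟨ hf _ ⟩
    ack cf (sum (⟦ gs ⟧* xs))     ≤⟨ ack-monoʳ-≤ cf (<⇒≤ (hgs xs)) ⟩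
    ack cf (ack cg (sum xs))      ≤⟨ ack-monoˡ-≤ _ (m≤m⊔n cf cg) ⟩
    ack (cf ⊔ cg) (ack cg (sum xs)) <⟨ ack-nested (cf ⊔ cg) cg _ (m≤n⊔m cf cg) ⟩
    ack (2 + (cf ⊔ cg)) (sum xs)  ∎
  where open ≤-Reasoning

-- The bound is proved for ⟦ rec f g ⟧ (y ∷ xs) + sum (y ∷ xs), which makes it inductive.
rec-ackBounded : ∀ {n} {f : PR n} {g : PR (2 + n)} {cf cg} → AckBounded f cf → AckBounded g cg →
                 AckBounded (rec f g) (5 + (cf ⊔ cg))
rec-ackBounded {n} {f} {g} {cf} {cg} hf hg (y ∷ xs) = ≤-<-trans (m≤m+n _ _) (bound y)
  where
  c = cf ⊔ cg
  h : ℕ → ℕ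
  h y = ⟦ rec f g ⟧ (y ∷ xs)
  bound : ∀ y → h y + (y + sum xs) < ack (5 + c) (y + sum xs)
  bound zero = begin-strict
    ⟦ f ⟧ xs + sum xs            <⟨ +-mono-<-≤ (hf xs) (<⇒≤ (<-ack cf _)) ⟩
    ack cf (sum xs) + ack cf (sum xs) <⟨ ack-double cf _ ⟩
    ack (4 + cf) (sum xs)        ≤⟨ ack-monoˡ-≤ (sum xs) (m≤n⇒m≤1+n (+-monoʳ-≤ 4 (m≤m⊔n cf cg))) ⟩
    ack (5 + c) (sum xs)         ∎
    where open ≤-Reasoning
  bound (suc y) = begin-strict
    h (suc y) + suc (y + sum xs) <⟨ +-mono-<-≤ (<-≤-trans (hg _) (ack-monoʳ-≤ cg (<⇒≤ args<u))) (<-ack (5 + c) _) ⟩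
    ack cg u + u                 ≤⟨ +-monoʳ-≤ (ack cg u) (<⇒≤ (<-ack cg u)) ⟩
    ack cg u + ack cg u          <⟨ ack-double cg u ⟩
    ack (4 + cg) u               ≤⟨ ack-monoˡ-≤ u (+-monoʳ-≤ 4 (m≤n⊔m cf cg)) ⟩
    ack (4 + c) u                ∎
    where
    open ≤-Reasoning
    u = ack (5 + c) (y + sum xs)
    args<u : y + (h y + sum xs) < u
    args<u = subst (_< u) (x∙yz≈y∙xz (h y) y (sum xs)) (bound y)

mutual
  ack-majorises : ∀ {n} (p : PR n) → Σ ℕ (AckBounded p)
  ack-majorises zeroF    = 0 , λ xs → s≤s z≤n
  ack-majorises sucF     = 1 , λ { (x ∷ []) → ≤-trans (s≤s (s≤s (m≤m+n x 0))) (ack-<-sucˡ 0 (x + 0)) }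
  ack-majorises (proj i) = 0 , λ xs → s≤s (lookup≤sum xs i)
  ack-majorises (comp f gs) with ack-majorises f | ack-majorises* gs
  ... | cf , hf | cg , hgs = 2 + (cf ⊔ cg) , comp-ackBounded {f = f} {gs} {cf} {cg} hf hgs
  ack-majorises (rec f g) with ack-majorises f | ack-majorises g
  ... | cf , hf | cg , hg = 5 + (cf ⊔ cg) , rec-ackBounded {f = f} {g} {cf} {cg} hf hg

  ack-majorises* : ∀ {m n} (ps : Vec (PR n) m) → Σ ℕ λ c → ∀ xs → sum (⟦ ps ⟧* xs) < ack c (sum xs)
  ack-majorises* [] = 0 , λ xs → s≤s z≤n
  ack-majorises* (p ∷ ps) with ack-majorises p | ack-majorises* ps
  ... | c₁ , h₁ | c₂ , h₂ = 4 + (c₁ ⊔ c₂) , λ xs → <-≤-trans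
    (+-mono-<-≤ (<-≤-trans (h₁ xs) (ack-monoˡ-≤ _ (m≤m⊔n c₁ c₂)))
                (<⇒≤ (<-≤-trans (h₂ xs) (ack-monoˡ-≤ _ (m≤n⊔m c₁ c₂)))))
    (<⇒≤ (ack-double (c₁ ⊔ c₂) _))

-- The witness row is n = c + x 0: large enough that ack n dominates the bound ack c,
-- and that the string (n + 1) listed by default indices does not contain x.
no-PR-bound : ∀ (x : Baire) → ((n : ℕ) → x ∈O row listingPR n) →
              ¬ (Σ (PR 1) λ g → BoundedBy x (λ k → ⟦ g ⟧ (k ∷ [])))
no-PR-bound x x∈V (g , x≤g) with ack-majorises g
... | c , g<ack with listing-points x (c + x 0) (x∈V (c + x 0))
... | inj₁ (m , ack≤xm) = <-irrefl refl (begin-strict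
    ack (c + x 0) m   ≤⟨ ack≤xm ⟩
    x m               ≤⟨ x≤g m ⟩
    ⟦ g ⟧ (m ∷ [])    <⟨ g<ack (m ∷ []) ⟩
    ack c (m + 0)     ≡⟨ cong (ack c) (+-identityʳ m) ⟩
    ack c m           ≤⟨ ack-monoˡ-≤ m (m≤m+n c (x 0)) ⟩
    ack (c + x 0) m   ∎)
  where open ≤-Reasoning
... | inj₂ x0≡1+n = contradiction (subst (_≤ c + x 0) x0≡1+n (m≤n+m (x 0) c)) (n≮n (c + x 0))

mainTheorem5 : Σ (PR 2) λ f →
    ((n : ℕ) → Dense (row f n)) ×
    ((x : Baire) → ((n : ℕ) → x ∈O row f n) →
      ¬ (Σ (PR 1) λ g → BoundedBy x (λ k → ⟦ g ⟧ (k ∷ []))))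
mainTheorem5 = listingPR , listing-dense , no-PR-bound
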